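{- Let $G=(V,E)$ be a graph, $k\ge 0$ an integer, and $M\subseteq V$ a module of $G$ such that $G[M]$ is trivially perfect. Suppose $G[M]$ contains an anti-matching $D$ of size $k+1$, and let $G'=G\setminus(M\setminus V(D))$ be the graph obtained by deleting the vertices of $M$ not covered by $D$. Then $(G,k)$ is a yes-instance of \textsc{Trivially Perfect Editing} if and only if $(G',k)$ is a yes-instance of \textsc{Trivially Perfect Editing}.
   Context: Graphs are finite, simple, undirected. A graph is trivially perfect if it has no induced $C_4$ and no induced $P_4$. For $F\subseteq[V]^2$, $G\triangle F=(V,E\triangle F)$. $(G,k)$ is a yes-instance of \textsc{Trivially Perfect Editing} if there is $F\subseteq[V]^2$ with $|F|\le k$ such that $G\triangle F$ is trivially perfect. A module of $G$ is a set $M$ with $N(u)\setminus M=N(v)\setminus M$ for all $u,v\in M$. An anti-matching is a set of pairwise disjoint pairs $\{u,v\}$ of vertices with $\{u,v\}\notin E$; its size is the number of pairs, and $V(D)$ is the set of vertices contained in pairs of $D$. For $S\subseteq V$, $G\setminus S$ denotes $G[V\setminus S]$. -}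

module Defs where

open import Data.Nat using (ℕ; suc; _≤_; _<_)
open import Data.Fin using (Fin; toℕ; _≟_)
open import Data.Bool using (Bool; true; false; _xor_; _∨_; _∧_; if_then_else_)
open import Data.List using (List; []; _∷_; length; concatMap)
open import Data.List.Membership.Propositional using (_∈_)
open import Data.List.Relation.Unary.All using (All)
open import Data.List.Relation.Unary.Unique.Propositional using (Unique)
open import Data.Product using (_×_; _,_; Σ; ∃)
open import Data.Sum using (_⊎_)
open import Data.Empty using (⊥)
open import Relation.Nullary using (¬_; does)
open import Relation.Binary.PropositionalEquality using (_≡_; _≢_)
open import Function using (_⇔_)

record Graph (n : ℕ) : Set where
  field
    adj    : Fin n → Fin n → Bool
    sym    : ∀ u v → adj u v ≡ adj v u
    irrefl : ∀ u → adj u u ≡ false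
open Graph public

VSet : ℕ → Set₁
VSet n = Fin n → Set

Full : ∀ {n} → VSet n
Full _ = Data.Unit.⊤ where import Data.Unit

Distinct4 : ∀ {n} → Fin n → Fin n → Fin n → Fin n → Set
Distinct4 a b c d = a ≢ b × a ≢ c × a ≢ d × b ≢ c × b ≢ d × c ≢ d

InducedP4 : ∀ {n} → (Fin n → Fin n → Bool) → VSet n → Fin n → Fin n → Fin n → Fin n → Set
InducedP4 e S a b c d =
  S a × S b × S c × S d × Distinct4 a b c d ×
  e a b ≡ true × e b c ≡ true × e c d ≡ true ×
  e a c ≡ false × e b d ≡ false × e a d ≡ false

InducedC4 : ∀ {n} → (Fin n → Fin n → Bool) → VSet n → Fin n → Fin n → Fin n → Fin n → Set
InducedC4 e S a b c d =
  S a × S b × S c × S d × Distinct4 a b c d ×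
  e a b ≡ true × e b c ≡ true × e c d ≡ true × e d a ≡ true ×
  e a c ≡ false × e b d ≡ false

TrivPerfOn : ∀ {n} → (Fin n → Fin n → Bool) → VSet n → Set
TrivPerfOn e S = ∀ a b c d → ¬ InducedP4 e S a b c d × ¬ InducedC4 e S a b c d

-- An edit set F ⊆ [V]^2: a duplicate-free list of pairs (u , v) with u < v
-- (so each unordered pair is listed once, as (min , max)); |F| = length F.
Pairs : ℕ → Set
Pairs n = List (Fin n × Fin n)

record EditSet (n : ℕ) : Set where
  field
    pairs   : Pairs n
    ordered : All (λ p → toℕ (Data.Product.proj₁ p) < toℕ (Data.Product.proj₂ p)) pairs
    unique  : Unique pairs
open EditSet public

memPair : ∀ {n} → Pairs n → Fin n → Fin n → Bool
memPair [] u v = false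
memPair ((a , b) ∷ ps) u v =
  ((does (a ≟ u) ∧ does (b ≟ v)) ∨ (does (a ≟ v) ∧ does (b ≟ u))) ∨ memPair ps u v

edited : ∀ {n} → Graph n → EditSet n → Fin n → Fin n → Bool
edited G F u v = adj G u v xor memPair (pairs F) u v

EditWithin : ∀ {n} → VSet n → EditSet n → Set
EditWithin S F = All (λ p → S (Data.Product.proj₁ p) × S (Data.Product.proj₂ p)) (pairs F)

-- (G[S] , k) is a yes-instance of Trivially Perfect Editing.
YesInstanceOn : ∀ {n} → Graph n → VSet n → ℕ → Set
YesInstanceOn G S k =
  Σ (EditSet _) λ F → EditWithin S F × length (pairs F) ≤ k × TrivPerfOn (edited G F) S

YesInstance : ∀ {n} → Graph n → ℕ → Set
YesInstance G k = YesInstanceOn G Full k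

IsModule : ∀ {n} → Graph n → VSet n → Set
IsModule G M = ∀ u v w → M u → M v → ¬ M w → adj G u w ≡ adj G v w

endpoints : ∀ {n} → Pairs n → List (Fin n)
endpoints = concatMap (λ p → Data.Product.proj₁ p ∷ Data.Product.proj₂ p ∷ [])

IsAntiMatchingIn : ∀ {n} → Graph n → VSet n → Pairs n → Set
IsAntiMatchingIn G M D =
  All (λ p → M (Data.Product.proj₁ p) × M (Data.Product.proj₂ p) ×
             adj G (Data.Product.proj₁ p) (Data.Product.proj₂ p) ≡ false) D ×
  Unique (endpoints D)

KeptVertices : ∀ {n} → VSet n → Pairs n → VSet n
KeptVertices M D v = ¬ M v ⊎ v ∈ endpoints D

-- Let P be the union of all decidable vertex sets that contain V(D), are modules of G and induce
-- trivially perfect graphs. Any two such sets share the non-adjacent pair of D's first pair, and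
-- this makes them closed under union; so P is again such a set, it contains M, and, unlike M, it is
-- decidable. Given a solution F with |F| ≤ k for G or for G', the k + 1 disjoint pairs of D cannot
-- all be touched by F, where an edit touches {u, v} if it joins u or v to u, v or a vertex outside P.
-- For an untouched pair {u, v}, the edits of F outside P still make G trivially perfect on
-- (V ∖ P) ∪ {u, v}, leave G[P] alone and keep P a module. An induced P4 or C4 meets a module in at most
-- one vertex, in all of them, or in two opposite vertices of a C4; accordingly it lies, up to replacing
-- its vertices in P by u and v, inside (V ∖ P) ∪ {u, v}, or it lies inside P. So these edits, at
-- most |F| of them and all outside M, solve both instances.
module Submission where

open import Defs hiding (sym)
open import Data.Nat using (ℕ; suc; _≤_; _<_; z≤n; s≤s)
open import Data.Nat.Properties using (≤-trans; ≤-reflexive; <⇒≱)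
open import Data.Fin using (Fin; _≟_)
import Data.Fin.Properties as Fin
open import Data.Fin.Subset as Subset using (Subset) renaming (_∈_ to _∈ₛ_)
open import Data.Fin.Subset.Properties using (anySubset?; x∈p∪q⁺; x∈p∪q⁻) renaming (_∈?_ to _∈ₛ?_)
open import Data.Bool using (Bool; true; false; _∨_; _∧_; _xor_)
import Data.Bool.Properties as Bool
open import Data.List using (List; []; _∷_; length; filter)
open import Data.List.Properties using (length-removeAt′; length-filter)
open import Data.List.Membership.Propositional using (_∈_; find; lose)
open import Data.List.Membership.Propositional.Properties using (∈-filter⁺; ∈-filter⁻; ∈-concatMap⁺; ∈-concatMap⁻)
import Data.List.Membership.DecPropositional as DecMembership
open import Data.List.Relation.Binary.Disjoint.Propositional using (Disjoint)
open import Data.List.Relation.Unary.All as All using (All; []; _∷_)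
import Data.List.Relation.Unary.All.Properties as All
open import Data.List.Relation.Unary.AllPairs using (AllPairs; []; _∷_)
open import Data.List.Relation.Unary.Any as Any using (Any; here; there; _─_)
open import Data.List.Relation.Unary.Linked using (Linked; [-]; _∷_)
open import Data.List.Relation.Unary.Unique.Propositional using (Unique)
import Data.List.Relation.Unary.Unique.Propositional.Properties as Unique
open import Data.Vec using (tabulate)
open import Data.Vec.Properties using (lookup∘tabulate; []=⇒lookup; lookup⇒[]=)
open import Data.Product using (_×_; _,_; proj₁; proj₂; Σ; ∃)
import Data.Product as Product
open import Data.Sum using (_⊎_; inj₁; inj₂; [_,_])
import Data.Sum as Sum
open import Data.Unit using (tt)
open import Data.Empty using (⊥; ⊥-elim)
open import Effect.Monad using (RawMonad)
open import Function using (_∘_; id; _⇔_; mk⇔; Equivalence)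
open import Relation.Nullary using (¬_; Dec; yes; no; does; contraposition)
open import Relation.Nullary.Decidable using (¬?; _×-dec_; _⊎-dec_; _→-dec_; map′; dec-true; decidable-stable; ¬¬-excluded-middle)
open import Relation.Nullary.Negation using (¬¬-Monad)
open import Relation.Unary using (Decidable; _⊆_; ∁; _∪_)
open import Relation.Binary.PropositionalEquality using (_≡_; _≢_; refl; sym; trans; cong; subst)

private
  variable
    n : ℕ

Adjacency : ℕ → Set
Adjacency n = Fin n → Fin n → Bool

IsModuleOf : Adjacency n → VSet n → Set
IsModuleOf e M = ∀ u v w → M u → M v → ¬ M w → e u w ≡ e v w

Admissible : Graph n → Pairs n → VSet n → Set
Admissible G D S = (∀ {z} → z ∈ endpoints D → S z) × IsModuleOf (adj G) S × TrivPerfOn (adj G) S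

vertices : Fin n × Fin n → List (Fin n)
vertices p = proj₁ p ∷ proj₂ p ∷ []

Shrunk : VSet n → Fin n × Fin n → VSet n
Shrunk P p = ∁ P ∪ (_∈ vertices p)

record InducedEmbedding (e : Adjacency n) (S : VSet n) (e′ : Adjacency n) (S′ : VSet n) : Set where
  field
    image     : ∀ {x} → S x → Fin n
    image∈    : ∀ {x} (s : S x) → S′ (image s)
    image-≢   : ∀ {x y} (s : S x) (t : S y) → x ≢ y → image s ≢ image t
    image-adj : ∀ {x y} (s : S x) (t : S y) → x ≢ y → e′ (image s) (image t) ≡ e x y

module _ {e e′ : Adjacency n} {S S′ : VSet n} where

  TrivPerfOn-embed : InducedEmbedding e S e′ S′ → TrivPerfOn e′ S′ → TrivPerfOn e S
  TrivPerfOn-embed emb tp a b c d = noP4 , noC4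
    where
    open InducedEmbedding emb
    noP4 : ¬ InducedP4 e S a b c d
    noP4 (sa , sb , sc , sd , (ab , ac , ad , bc , bd , cd) , hab , hbc , hcd , hac , hbd , had) =
      proj₁ (tp (image sa) (image sb) (image sc) (image sd))
        ( image∈ sa , image∈ sb , image∈ sc , image∈ sd
        , ( image-≢ sa sb ab , image-≢ sa sc ac , image-≢ sa sd ad
          , image-≢ sb sc bc , image-≢ sb sd bd , image-≢ sc sd cd )
        , trans (image-adj sa sb ab) hab , trans (image-adj sb sc bc) hbc , trans (image-adj sc sd cd) hcd
        , trans (image-adj sa sc ac) hac , trans (image-adj sb sd bd) hbd , trans (image-adj sa sd ad) had )
    noC4 : ¬ InducedC4 e S a b c d
    noC4 (sa , sb , sc , sd , (ab , ac , ad , bc , bd , cd) , hab , hbc , hcd , hda , hac , hbd) =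
      proj₂ (tp (image sa) (image sb) (image sc) (image sd))
        ( image∈ sa , image∈ sb , image∈ sc , image∈ sd
        , ( image-≢ sa sb ab , image-≢ sa sc ac , image-≢ sa sd ad
          , image-≢ sb sc bc , image-≢ sb sd bd , image-≢ sc sd cd )
        , trans (image-adj sa sb ab) hab , trans (image-adj sb sc bc) hbc , trans (image-adj sc sd cd) hcd
        , trans (image-adj sd sa (ad ∘ sym)) hda , trans (image-adj sa sc ac) hac , trans (image-adj sb sd bd) hbd )

  TrivPerfOn-restrict : S ⊆ S′ → (∀ {x y} → S x → S y → e′ x y ≡ e x y) → TrivPerfOn e′ S′ → TrivPerfOn e S
  TrivPerfOn-restrict S⊆S′ agree = TrivPerfOn-embed record
    { image = λ {x} _ → x ; image∈ = S⊆S′ ; image-≢ = λ _ _ x≢y → x≢y ; image-adj = λ s t _ → agree s t }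

TrivPerfOn-anti : ∀ {e : Adjacency n} {S S′ : VSet n} → S ⊆ S′ → TrivPerfOn e S′ → TrivPerfOn e S
TrivPerfOn-anti S⊆S′ = TrivPerfOn-restrict S⊆S′ (λ _ _ → refl)

-- Shrinking a module

module ModuleSubstitution {e : Adjacency n} (e-sym : ∀ x y → e x y ≡ e y x)
                          {P : VSet n} (P-mod : IsModuleOf e P) where

  e-flip : ∀ {x y b} → e x y ≡ b → e y x ≡ b
  e-flip {x} {y} = trans (e-sym y x)

  twin-embedding : ∀ {z₁ z₂ u v} → P z₁ → P z₂ → P u → P v → u ≢ v → (z₁ ≢ z₂ → e z₁ z₂ ≡ e u v) →
                   InducedEmbedding e (Shrunk P (z₁ , z₂)) e (Shrunk P (u , v))
  twin-embedding {z₁} {z₂} {u} {v} Pz₁ Pz₂ Pu Pv u≢v e-z₁z₂ =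
    record { image = image ; image∈ = image∈ ; image-≢ = image-≢ ; image-adj = image-adj }
    where
    image : ∀ {x} → Shrunk P (z₁ , z₂) x → Fin _
    image {x} (inj₁ _)                = x
    image     (inj₂ (here _))         = u
    image     (inj₂ (there (here _))) = v

    image∈ : ∀ {x} (s : Shrunk P (z₁ , z₂) x) → Shrunk P (u , v) (image s)
    image∈ (inj₁ ¬Px)              = inj₁ ¬Px
    image∈ (inj₂ (here _))         = inj₂ (here refl)
    image∈ (inj₂ (there (here _))) = inj₂ (there (here refl))

    inner : ∀ {x} (m : x ∈ vertices (z₁ , z₂)) → P x × P (image (inj₂ m))
    inner (here refl)         = Pz₁ , Pu
    inner (there (here refl)) = Pz₂ , Pv

    image-≢ : ∀ {x y} (s : Shrunk P (z₁ , z₂) x) (t : Shrunk P (z₁ , z₂) y) → x ≢ y → image s ≢ image t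
    image-≢ (inj₁ _)                   (inj₁ _)                   x≢y = x≢y
    image-≢ (inj₁ ¬Px)                 (inj₂ m)                   _   = λ x≡ → ¬Px (subst P (sym x≡) (proj₂ (inner m)))
    image-≢ (inj₂ m)                   (inj₁ ¬Py)                 _   = λ ≡y → ¬Py (subst P ≡y (proj₂ (inner m)))
    image-≢ (inj₂ (here refl))         (inj₂ (here refl))         x≢y = ⊥-elim (x≢y refl)
    image-≢ (inj₂ (here refl))         (inj₂ (there (here refl))) _   = u≢v
    image-≢ (inj₂ (there (here refl))) (inj₂ (here refl))         _   = u≢v ∘ sym
    image-≢ (inj₂ (there (here refl))) (inj₂ (there (here refl))) x≢y = ⊥-elim (x≢y refl)

    image-adj : ∀ {x y} (s : Shrunk P (z₁ , z₂) x) (t : Shrunk P (z₁ , z₂) y) → x ≢ y → e (image s) (image t) ≡ e x y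
    image-adj (inj₁ _)                   (inj₁ _)                   _   = refl
    image-adj {x} {y} (inj₁ ¬Px)         (inj₂ m)                   _   =
      e-flip (trans (P-mod _ y x (proj₂ (inner m)) (proj₁ (inner m)) ¬Px) (e-sym y x))
    image-adj (inj₂ m)                   (inj₁ ¬Py)                 _   = P-mod _ _ _ (proj₂ (inner m)) (proj₁ (inner m)) ¬Py
    image-adj (inj₂ (here refl))         (inj₂ (here refl))         x≢y = ⊥-elim (x≢y refl)
    image-adj (inj₂ (here refl))         (inj₂ (there (here refl))) x≢y = sym (e-z₁z₂ x≢y)
    image-adj (inj₂ (there (here refl))) (inj₂ (here refl))         x≢y = e-flip (sym (e-flip (e-z₁z₂ (x≢y ∘ sym))))
    image-adj (inj₂ (there (here refl))) (inj₂ (there (here refl))) x≢y = ⊥-elim (x≢y refl)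

  module-substitution : Decidable P → ∀ {u v} → P u → P v → u ≢ v → e u v ≡ false →
                        TrivPerfOn e P → TrivPerfOn e (Shrunk P (u , v)) → TrivPerfOn e Full
  module-substitution P? {u} {v} Pu Pv u≢v u≁v tp-P tp-uv a b c d = noP4 , noC4
    where
    shrunk-tp : ∀ {z₁ z₂} → P z₁ → P z₂ → (z₁ ≢ z₂ → e z₁ z₂ ≡ false) → TrivPerfOn e (Shrunk P (z₁ , z₂))
    shrunk-tp Pz₁ Pz₂ z₁≁z₂ = TrivPerfOn-embed (twin-embedding Pz₁ Pz₂ Pu Pv u≢v (λ ne → trans (z₁≁z₂ ne) (sym u≁v))) tp-uv

    shrunk-tp₁ : ∀ {z} → P z → TrivPerfOn e (Shrunk P (z , z))
    shrunk-tp₁ Pz = shrunk-tp Pz Pz (λ z≢z → ⊥-elim (z≢z refl))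

    splits : ∀ {x y z} → P x → P y → ¬ P z → e x z ≡ true → e y z ≡ false → ⊥
    splits {x} {y} {z} Px Py ¬Pz x∼z y≁z with () ← trans (sym x∼z) (trans (P-mod x y z Px Py ¬Pz) y≁z)

    first : ∀ {x y} → Shrunk P (x , y) x
    first = inj₂ (here refl)

    second : ∀ {x y} → Shrunk P (y , x) x
    second = inj₂ (there (here refl))

    noP4 : ¬ InducedP4 e Full a b c d
    noP4 (_ , _ , _ , _ , rest@(_ , hab , hbc , hcd , hac , hbd , had)) with P? a | P? b | P? c | P? d
    ... | yes pa | yes pb | yes pc | yes pd = proj₁ (tp-P a b c d) (pa , pb , pc , pd , rest)
    ... | yes pa | no nb  | no nc  | no nd  = proj₁ (shrunk-tp₁ pa a b c d) (first , inj₁ nb , inj₁ nc , inj₁ nd , rest)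
    ... | no na  | yes pb | no nc  | no nd  = proj₁ (shrunk-tp₁ pb a b c d) (inj₁ na , first , inj₁ nc , inj₁ nd , rest)
    ... | no na  | no nb  | yes pc | no nd  = proj₁ (shrunk-tp₁ pc a b c d) (inj₁ na , inj₁ nb , first , inj₁ nd , rest)
    ... | no na  | no nb  | no nc  | yes pd = proj₁ (shrunk-tp₁ pd a b c d) (inj₁ na , inj₁ nb , inj₁ nc , first , rest)
    ... | no na  | no nb  | no nc  | no nd  = proj₁ (tp-uv a b c d) (inj₁ na , inj₁ nb , inj₁ nc , inj₁ nd , rest)
    ... | yes pa | yes pb | no nc  | _      = splits pb pa nc hbc hac
    ... | yes pa | yes pb | yes pc | no nd  = splits pc pa nd hcd had
    ... | yes pa | no nb  | yes pc | no nd  = splits pc pa nd hcd had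
    ... | yes pa | no nb  | yes pc | yes pd = splits pa pd nb hab (e-flip hbd)
    ... | yes pa | no nb  | no nc  | yes pd = splits pa pd nb hab (e-flip hbd)
    ... | no na  | yes pb | yes pc | _      = splits pb pc na (e-flip hab) (e-flip hac)
    ... | no na  | yes pb | no nc  | yes pd = splits pb pd na (e-flip hab) (e-flip had)
    ... | no na  | no nb  | yes pc | yes pd = splits pc pd nb (e-flip hbc) (e-flip hbd)

    noC4 : ¬ InducedC4 e Full a b c d
    noC4 (_ , _ , _ , _ , rest@(_ , hab , hbc , hcd , hda , hac , hbd)) with P? a | P? b | P? c | P? d
    ... | yes pa | yes pb | yes pc | yes pd = proj₂ (tp-P a b c d) (pa , pb , pc , pd , rest)
    ... | yes pa | no nb  | no nc  | no nd  = proj₂ (shrunk-tp₁ pa a b c d) (first , inj₁ nb , inj₁ nc , inj₁ nd , rest)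
    ... | no na  | yes pb | no nc  | no nd  = proj₂ (shrunk-tp₁ pb a b c d) (inj₁ na , first , inj₁ nc , inj₁ nd , rest)
    ... | no na  | no nb  | yes pc | no nd  = proj₂ (shrunk-tp₁ pc a b c d) (inj₁ na , inj₁ nb , first , inj₁ nd , rest)
    ... | no na  | no nb  | no nc  | yes pd = proj₂ (shrunk-tp₁ pd a b c d) (inj₁ na , inj₁ nb , inj₁ nc , first , rest)
    ... | no na  | no nb  | no nc  | no nd  = proj₂ (tp-uv a b c d) (inj₁ na , inj₁ nb , inj₁ nc , inj₁ nd , rest)
    ... | yes pa | no nb  | yes pc | no nd  = proj₂ (shrunk-tp pa pc (λ _ → hac) a b c d) (first , inj₁ nb , second , inj₁ nd , rest)
    ... | no na  | yes pb | no nc  | yes pd = proj₂ (shrunk-tp pb pd (λ _ → hbd) a b c d) (inj₁ na , first , inj₁ nc , second , rest)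
    ... | yes pa | yes pb | yes pc | no nd  = splits pa pb nd (e-flip hda) hbd
    ... | yes pa | yes pb | no nc  | _      = splits pb pa nc hbc hac
    ... | yes pa | no nb  | _      | yes pd = splits pa pd nb hab (e-flip hbd)
    ... | no na  | yes pb | yes pc | _      = splits pb pc na (e-flip hab) (e-flip hac)
    ... | no na  | no nb  | yes pc | yes pd = splits pc pd nb (e-flip hbc) (e-flip hbd)

-- Unions of overlapping modules

linked-spread : ∀ {A : Set} {R : A → A → Set} {Q : A → Set} → (∀ {x y} → R x y → Q x ⇔ Q y) →
                ∀ {xs} → Linked R xs → Any Q xs → All Q xs
linked-spread inv [-]        (here q)  = q ∷ []
linked-spread inv (r ∷ walk) (here q)  = q ∷ linked-spread inv walk (here (Equivalence.to (inv r) q))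
linked-spread inv (r ∷ walk) (there a) with qs@(q ∷ _) ← linked-spread inv walk a = Equivalence.from (inv r) q ∷ qs

module ModuleUnion (G : Graph n) {S₁ S₂ : VSet n} (S₁? : Decidable S₁) (S₂? : Decidable S₂)
                   (mod₁ : IsModuleOf (adj G) S₁) (mod₂ : IsModuleOf (adj G) S₂)
                   (tp₁ : TrivPerfOn (adj G) S₁) (tp₂ : TrivPerfOn (adj G) S₂)
                   {u v : Fin n} (u₁ : S₁ u) (u₂ : S₂ u) (v₁ : S₁ v) (v₂ : S₂ v)
                   (u≢v : u ≢ v) (u≁v : adj G u v ≡ false) where

  adj-flip : ∀ {x y b} → adj G x y ≡ b → adj G y x ≡ b
  adj-flip {x} {y} = trans (Graph.sym G y x)

  ∪-module : IsModuleOf (adj G) (S₁ ∪ S₂)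
  ∪-module a b w sa sb ¬sw = trans (towards-u sa) (sym (towards-u sb))
    where
    towards-u : ∀ {x} → (S₁ ∪ S₂) x → adj G x w ≡ adj G u w
    towards-u (inj₁ s) = mod₁ _ u w s u₁ (¬sw ∘ inj₁)
    towards-u (inj₂ s) = mod₂ _ u w s u₂ (¬sw ∘ inj₂)

  cross : ∀ {x y} → S₁ x → ¬ S₂ x → S₂ y → ¬ S₁ y → adj G u x ≡ adj G u y
  cross {x} {y} s₁x ¬s₂x s₂y ¬s₁y =
    trans (sym (mod₂ y u x s₂y u₂ ¬s₂x)) (trans (Graph.sym G y x) (mod₁ x u y s₁x u₁ ¬s₁y))

  Edge∪ : Fin n → Fin n → Set
  Edge∪ x y = (S₁ ∪ S₂) x × (S₁ ∪ S₂) y × adj G x y ≡ true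

  HasNonNeighbourIn : List (Fin n) → Set
  HasNonNeighbourIn qs = ∀ {x} → x ∈ qs → ∃ λ y → y ∈ qs × x ≢ y × adj G x y ≡ false

  -- By cross, u is adjacent to all vertices private to S₁ or to none. If to all, a non-neighbour y
  -- of x₁ must be private to S₁ too, and x₁ u y v is a C4 in S₁; if to none, no edge leaves S₂.
  no-straddle : ∀ {qs} → All (S₁ ∪ S₂) qs → Linked Edge∪ qs → HasNonNeighbourIn qs →
                ∀ {x₁ x₂} → x₁ ∈ qs → ¬ S₂ x₁ → x₂ ∈ qs → ¬ S₁ x₂ → ⊥
  no-straddle {qs} all∪ walk nonadj {x₁} {x₂} x₁∈ ¬s₂x₁ x₂∈ ¬s₁x₂ = by-cases (adj G u x₁) refl
    where
    s₁x₁ : S₁ x₁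
    s₁x₁ = [ id , ⊥-elim ∘ ¬s₂x₁ ] (All.lookup all∪ x₁∈)

    s₂x₂ : S₂ x₂
    s₂x₂ = [ ⊥-elim ∘ ¬s₁x₂ , id ] (All.lookup all∪ x₂∈)

    uniform : ∀ {x} → S₁ x → ¬ S₂ x → adj G u x ≡ adj G u x₁
    uniform s₁x ¬s₂x = trans (cross s₁x ¬s₂x s₂x₂ ¬s₁x₂) (sym (cross s₁x₁ ¬s₂x₁ s₂x₂ ¬s₁x₂))

    by-cases : ∀ b → adj G u x₁ ≡ b → ⊥
    by-cases true u∼x₁ with nonadj x₁∈
    ... | y , y∈ , x₁≢y , x₁≁y with S₂? y
    ...   | yes s₂y with () ← trans (sym u∼x₁) (trans (sym (mod₂ y u x₁ s₂y u₂ ¬s₂x₁)) (adj-flip x₁≁y))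
    ...   | no ¬s₂y =
      proj₂ (tp₁ x₁ u y v)
        ( s₁x₁ , u₁ , s₁y , v₁
        , ( (λ x₁≡u → ¬s₂x₁ (subst S₂ (sym x₁≡u) u₂)) , x₁≢y , (λ x₁≡v → ¬s₂x₁ (subst S₂ (sym x₁≡v) v₂))
          , (λ u≡y → ¬s₂y (subst S₂ u≡y u₂)) , u≢v , (λ y≡v → ¬s₂y (subst S₂ (sym y≡v) v₂)) )
        , adj-flip u∼x₁ , trans (uniform s₁y ¬s₂y) u∼x₁
        , adj-flip (trans (mod₂ v u y v₂ u₂ ¬s₂y) (trans (uniform s₁y ¬s₂y) u∼x₁))
        , trans (mod₂ v u x₁ v₂ u₂ ¬s₂x₁) u∼x₁ , x₁≁y , u≁v )
      where
      s₁y : S₁ y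
      s₁y = [ id , ⊥-elim ∘ ¬s₂y ] (All.lookup all∪ y∈)
    by-cases false u≁x₁ = ¬s₂x₁ (All.lookup (linked-spread invariant walk (lose x₂∈ s₂x₂)) x₁∈)
      where
      no-edge : ∀ {x y} → S₂ x → (S₁ ∪ S₂) y → adj G x y ≡ true → S₂ y
      no-edge {x} {y} s₂x y∈∪ x∼y with S₂? y
      ... | yes s₂y = s₂y
      ... | no ¬s₂y with () ← trans (sym x∼y)
                               (trans (mod₂ x u y s₂x u₂ ¬s₂y) (trans (uniform ([ id , ⊥-elim ∘ ¬s₂y ] y∈∪) ¬s₂y) u≁x₁))

      invariant : ∀ {x y} → Edge∪ x y → S₂ x ⇔ S₂ y
      invariant (x∈∪ , y∈∪ , x∼y) = mk⇔ (λ s₂x → no-edge s₂x y∈∪ x∼y) (λ s₂y → no-edge s₂y x∈∪ (adj-flip x∼y))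

  one-side : ∀ {qs} → All (S₁ ∪ S₂) qs → Linked Edge∪ qs → HasNonNeighbourIn qs → ¬ All S₁ qs → ¬ All S₂ qs → ⊥
  one-side {qs} all∪ walk nonadj ¬all₁ ¬all₂
    with x₂ , x₂∈ , ¬s₁x₂ ← find (All.¬All⇒Any¬ S₁? qs ¬all₁)
       | x₁ , x₁∈ , ¬s₂x₁ ← find (All.¬All⇒Any¬ S₂? qs ¬all₂)
    = no-straddle all∪ walk nonadj x₁∈ ¬s₂x₁ x₂∈ ¬s₁x₂

  ∪-trivPerf : TrivPerfOn (adj G) (S₁ ∪ S₂)
  ∪-trivPerf a b c d = noP4 , noC4
    where
    qa : a ∈ a ∷ b ∷ c ∷ d ∷ []
    qa = here refl
    qb : b ∈ a ∷ b ∷ c ∷ d ∷ []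
    qb = there (here refl)
    qc : c ∈ a ∷ b ∷ c ∷ d ∷ []
    qc = there (there (here refl))
    qd : d ∈ a ∷ b ∷ c ∷ d ∷ []
    qd = there (there (there (here refl)))

    noP4 : ¬ InducedP4 (adj G) (S₁ ∪ S₂) a b c d
    noP4 (sa , sb , sc , sd , rest@((_ , ac , ad , _ , bd , _) , hab , hbc , hcd , hac , hbd , had)) =
      one-side (sa ∷ sb ∷ sc ∷ sd ∷ []) ((sa , sb , hab) ∷ (sb , sc , hbc) ∷ (sc , sd , hcd) ∷ [-])
        (λ { (here refl)                         → c , qc , ac , hac
           ; (there (here refl))                 → d , qd , bd , hbd
           ; (there (there (here refl)))         → a , qa , ac ∘ sym , adj-flip hac
           ; (there (there (there (here refl)))) → a , qa , ad ∘ sym , adj-flip had })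
        (λ { (s ∷ t ∷ w ∷ z ∷ []) → proj₁ (tp₁ a b c d) (s , t , w , z , rest) })
        (λ { (s ∷ t ∷ w ∷ z ∷ []) → proj₁ (tp₂ a b c d) (s , t , w , z , rest) })

    noC4 : ¬ InducedC4 (adj G) (S₁ ∪ S₂) a b c d
    noC4 (sa , sb , sc , sd , rest@((_ , ac , _ , _ , bd , _) , hab , hbc , hcd , _ , hac , hbd)) =
      one-side (sa ∷ sb ∷ sc ∷ sd ∷ []) ((sa , sb , hab) ∷ (sb , sc , hbc) ∷ (sc , sd , hcd) ∷ [-])
        (λ { (here refl)                         → c , qc , ac , hac
           ; (there (here refl))                 → d , qd , bd , hbd
           ; (there (there (here refl)))         → a , qa , ac ∘ sym , adj-flip hac
           ; (there (there (there (here refl)))) → b , qb , bd ∘ sym , adj-flip hbd })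
        (λ { (s ∷ t ∷ w ∷ z ∷ []) → proj₂ (tp₁ a b c d) (s , t , w , z , rest) })
        (λ { (s ∷ t ∷ w ∷ z ∷ []) → proj₂ (tp₂ a b c d) (s , t , w , z , rest) })

UnorderedIn : Fin n → Fin n → Pairs n → Set
UnorderedIn x y ps = (x , y) ∈ ps ⊎ (y , x) ∈ ps

memPair-sound : ∀ (ps : Pairs n) {x y} → memPair ps x y ≡ true → UnorderedIn x y ps
memPair-sound ((a , b) ∷ ps) {x} {y} h with a ≟ x | b ≟ y | a ≟ y | b ≟ x
... | yes refl | yes refl | _        | _        = inj₁ (here refl)
... | _        | _        | yes refl | yes refl = inj₂ (here refl)
... | no _     | _        | no _     | _        = Sum.map there there (memPair-sound ps h)
... | no _     | _        | yes _    | no _     = Sum.map there there (memPair-sound ps h)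
... | yes _    | no _     | no _     | _        = Sum.map there there (memPair-sound ps h)
... | yes _    | no _     | yes _    | no _     = Sum.map there there (memPair-sound ps h)

memPair-complete : ∀ (ps : Pairs n) {x y} → UnorderedIn x y ps → memPair ps x y ≡ true
memPair-complete ((x , y) ∷ ps) (inj₁ (here refl)) rewrite dec-true (x ≟ x) refl | dec-true (y ≟ y) refl = refl
memPair-complete ((y , x) ∷ ps) (inj₂ (here refl)) rewrite dec-true (x ≟ x) refl | dec-true (y ≟ y) refl =
  cong (_∨ memPair ps x y) (Bool.∨-zeroʳ (does (y ≟ x) ∧ does (x ≟ y)))
memPair-complete (_ ∷ ps) (inj₁ (there i)) = trans (cong (_ ∨_) (memPair-complete ps (inj₁ i))) (Bool.∨-zeroʳ _)
memPair-complete (_ ∷ ps) (inj₂ (there i)) = trans (cong (_ ∨_) (memPair-complete ps (inj₂ i))) (Bool.∨-zeroʳ _)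

memPair-false : ∀ {ps : Pairs n} {x y} → ¬ UnorderedIn x y ps → memPair ps x y ≡ false
memPair-false = Bool.¬-not ∘ contraposition (memPair-sound _)

memPair-sym : ∀ (ps : Pairs n) x y → memPair ps x y ≡ memPair ps y x
memPair-sym ps x y = Bool.⇔→≡ (mk⇔ swap swap)
  where
  swap : ∀ {x y} → memPair ps x y ≡ true → memPair ps y x ≡ true
  swap = memPair-complete ps ∘ Sum.swap ∘ memPair-sound ps

edited-sym : ∀ (G : Graph n) F x y → edited G F x y ≡ edited G F y x
edited-sym G F x y rewrite Graph.sym G x y | memPair-sym (pairs F) x y = refl

module _ {P : VSet n} (P? : Decidable P) where

  Outside : Fin n × Fin n → Set
  Outside q = ¬ P (proj₁ q) × ¬ P (proj₂ q)

  outside? : Decidable Outside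
  outside? q = ¬? (P? (proj₁ q)) ×-dec ¬? (P? (proj₂ q))

  editsOutside : EditSet n → EditSet n
  editsOutside F = record
    { pairs   = filter outside? (pairs F)
    ; ordered = All.filter⁺ outside? (ordered F)
    ; unique  = Unique.filter⁺ outside? (unique F) }

  memPair-outside : ∀ ps {x y} → ¬ P x → ¬ P y → memPair (filter outside? ps) x y ≡ memPair ps x y
  memPair-outside ps ¬Px ¬Py = Bool.⇔→≡ (mk⇔
    (memPair-complete ps ∘ Sum.map (proj₁ ∘ ∈-filter⁻ outside?) (proj₁ ∘ ∈-filter⁻ outside?) ∘ memPair-sound _)
    (memPair-complete _ ∘ Sum.map (λ i → ∈-filter⁺ outside? i (¬Px , ¬Py)) (λ i → ∈-filter⁺ outside? i (¬Py , ¬Px))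
                        ∘ memPair-sound ps))

  memPair-inside : ∀ ps {x y} → P x → memPair (filter outside? ps) x y ≡ false
  memPair-inside ps Px = memPair-false λ
    { (inj₁ i) → proj₁ (proj₂ (∈-filter⁻ outside? {xs = ps} i)) Px
    ; (inj₂ i) → proj₂ (proj₂ (∈-filter⁻ outside? {xs = ps} i)) Px }

-- Untouched pairs of an anti-matching

Any-─ : ∀ {B : Set} {P Q : B → Set} {ys} (h : Any P ys) → (∀ {y} → P y → Q y → ⊥) → Any Q ys → Any Q (ys ─ h)
Any-─ (here p)  excl (here q)  = ⊥-elim (excl p q)
Any-─ (here _)  _    (there q) = q
Any-─ (there _) _    (here q)  = here q
Any-─ (there h) excl (there q) = there (Any-─ h excl q)

exclusive-hits⇒≤ : ∀ {A B : Set} {R : B → A → Set} {xs : List A} {ys : List B} →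
                   AllPairs (λ x x′ → ∀ {y} → R y x → R y x′ → ⊥) xs →
                   All (λ x → Any (λ y → R y x) ys) xs → length xs ≤ length ys
exclusive-hits⇒≤ []                                 []       = z≤n
exclusive-hits⇒≤ {R = R} {x ∷ _} {ys} (excl ∷ excls) (h ∷ hs) =
  ≤-trans (s≤s (exclusive-hits⇒≤ excls (All.zipWith still-hit (excl , hs))))
          (≤-reflexive (sym (length-removeAt′ ys (Any.index h))))
  where
  still-hit : ∀ {x′} → (∀ {y} → R y x → R y x′ → ⊥) × Any (λ y → R y x′) ys → Any (λ y → R y x′) (ys ─ h)
  still-hit (e , h′) = Any-─ h e h′

-- The edits that can change adjacency inside Shrunk P p at a vertex of p.
Touches : VSet n → Fin n × Fin n → Fin n × Fin n → Set
Touches P p q = Any (_∈ vertices p) (vertices q) × All (Shrunk P p) (vertices q)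

touches? : ∀ {P : VSet n} → Decidable P → ∀ p → Decidable (Touches P p)
touches? {n} P? p q = Any.any? (_∈? vertices p) (vertices q) ×-dec All.all? (λ z → ¬? (P? z) ⊎-dec (z ∈? vertices p)) (vertices q)
  where open DecMembership (_≟_ {n}) using (_∈?_)

touch-exclusive : ∀ {P : VSet n} {p p′ q} → (∀ {z} → z ∈ vertices p → P z) → Disjoint (vertices p) (vertices p′) →
                  Touches P p q → Touches P p′ q → ⊥
touch-exclusive p⊆P disjoint (meets , _) (_ , within′) with z , z∈q , z∈p ← find meets with All.lookup within′ z∈q
... | inj₁ ¬Pz  = ¬Pz (p⊆P z∈p)
... | inj₂ z∈p′ = disjoint (z∈p , z∈p′)

untouched-memPair : ∀ {P : VSet n} {p F x y} → ¬ Any (Touches P p) F → x ∈ vertices p → Shrunk P p y → memPair F x y ≡ false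
untouched-memPair ¬touch x∈p y∈ = memPair-false λ
  { (inj₁ xy∈F) → ¬touch (lose xy∈F (here x∈p , inj₂ x∈p ∷ y∈ ∷ []))
  ; (inj₂ yx∈F) → ¬touch (lose yx∈F (there (here x∈p) , y∈ ∷ inj₂ x∈p ∷ [])) }

∈-endpoints : ∀ {D : Pairs n} {p z} → p ∈ D → z ∈ vertices p → z ∈ endpoints D
∈-endpoints p∈D z∈p = ∈-concatMap⁺ vertices (lose p∈D z∈p)

touches-pairwise-exclusive : ∀ {P : VSet n} {D : Pairs n} → (∀ {z} → z ∈ endpoints D → P z) → Unique (endpoints D) →
                             AllPairs (λ p p′ → ∀ {q} → Touches P p q → Touches P p′ q → ⊥) D
touches-pairwise-exclusive {D = []}    _   _                      = []
touches-pairwise-exclusive {D = p ∷ D} D⊆P ((_ ∷ x∉) ∷ y∉ ∷ uniq) =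
  All.tabulate (λ p′∈ → touch-exclusive (λ z∈p → D⊆P (∈-endpoints {D = p ∷ D} (here refl) z∈p)) (disjoint p′∈))
  ∷ touches-pairwise-exclusive (λ z∈ → D⊆P (there (there z∈))) uniq
  where
  disjoint : ∀ {p′} → p′ ∈ D → Disjoint (vertices p) (vertices p′)
  disjoint p′∈ (here refl , z∈p′)         = All.lookup x∉ (∈-endpoints p′∈ z∈p′) refl
  disjoint p′∈ (there (here refl) , z∈p′) = All.lookup y∉ (∈-endpoints p′∈ z∈p′) refl

endpoints-distinct : ∀ {D : Pairs n} → Unique (endpoints D) → All (λ p → proj₁ p ≢ proj₂ p) D
endpoints-distinct {D = []}    _                      = []
endpoints-distinct {D = _ ∷ _} ((x≢y ∷ _) ∷ _ ∷ uniq) = x≢y ∷ endpoints-distinct uniq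

module Shrinking (G : Graph n) {D : Pairs n} (D-anti : All (λ p → adj G (proj₁ p) (proj₂ p) ≡ false) D)
                 (D-unique : Unique (endpoints D)) {P : VSet n} (P? : Decidable P) (P-adm : Admissible G D P) where

  D⊆P : ∀ {z} → z ∈ endpoints D → P z
  D⊆P = proj₁ P-adm

  P-mod : IsModuleOf (adj G) P
  P-mod = proj₁ (proj₂ P-adm)

  P-tp : TrivPerfOn (adj G) P
  P-tp = proj₂ (proj₂ P-adm)

  untouched-pair : ∀ (F : Pairs n) → length F < length D → ∃ λ p → p ∈ D × ¬ Any (Touches P p) F
  untouched-pair F |F|<|D| = find (All.¬All⇒Any¬ (λ p → Any.any? (touches? P? p) F) D not-all-hit)
    where
    not-all-hit : ¬ All (λ p → Any (Touches P p) F) D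
    not-all-hit = <⇒≱ |F|<|D| ∘ exclusive-hits⇒≤ (touches-pairwise-exclusive D⊆P D-unique)

  shrink : ∀ (F : EditSet n) → length (pairs F) < length D → TrivPerfOn (edited G F) (∁ P ∪ (_∈ endpoints D)) →
           Σ (EditSet n) λ F′ → EditWithin (∁ P) F′ × length (pairs F′) ≤ length (pairs F) × TrivPerfOn (edited G F′) Full
  shrink F |F|<|D| tp-F with (u , v) , uv∈D , untouched ← untouched-pair (pairs F) |F|<|D| =
    F′ , All.all-filter (outside? P?) (pairs F) , length-filter (outside? P?) (pairs F) ,
    ModuleSubstitution.module-substitution (edited-sym G F′) F′-module P? (P-of (here refl)) (P-of (there (here refl)))
      (All.lookup (endpoints-distinct D-unique) uv∈D) (trans (F′-inside (P-of (here refl))) (All.lookup D-anti uv∈D))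
      F′-tp-P (TrivPerfOn-restrict shrunk⊆ edits-agree tp-F)
    where
    F′ : EditSet n
    F′ = editsOutside P? F

    P-of : ∀ {z} → z ∈ vertices (u , v) → P z
    P-of = D⊆P ∘ ∈-endpoints uv∈D

    F′-inside : ∀ {x y} → P x → edited G F′ x y ≡ adj G x y
    F′-inside {x} {y} Px = trans (cong (adj G x y xor_) (memPair-inside P? (pairs F) Px)) (Bool.xor-identityʳ _)

    F′-module : IsModuleOf (edited G F′) P
    F′-module a b w Pa Pb ¬Pw = trans (F′-inside Pa) (trans (P-mod a b w Pa Pb ¬Pw) (sym (F′-inside Pb)))

    F′-tp-P : TrivPerfOn (edited G F′) P
    F′-tp-P = TrivPerfOn-restrict id (λ Px _ → sym (F′-inside Px)) P-tp

    shrunk⊆ : Shrunk P (u , v) ⊆ ∁ P ∪ (_∈ endpoints D)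
    shrunk⊆ (inj₁ ¬Px) = inj₁ ¬Px
    shrunk⊆ (inj₂ x∈)  = inj₂ (∈-endpoints uv∈D x∈)

    edits-agree : ∀ {x y} → Shrunk P (u , v) x → Shrunk P (u , v) y → edited G F x y ≡ edited G F′ x y
    edits-agree {x} {y} (inj₁ ¬Px) (inj₁ ¬Py) = cong (adj G x y xor_) (sym (memPair-outside P? (pairs F) ¬Px ¬Py))
    edits-agree {x} {y} (inj₂ x∈) t =
      trans (cong (adj G x y xor_) (untouched-memPair untouched x∈ t)) (trans (Bool.xor-identityʳ _) (sym (F′-inside (P-of x∈))))
    edits-agree {x} {y} s@(inj₁ _) t@(inj₂ _) =
      trans (edited-sym G F x y) (trans (edits-agree t s) (edited-sym G F′ y x))

-- The decidable hull of admissible sets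

¬¬-decidable : (M : VSet n) → ¬ ¬ Decidable M
¬¬-decidable M = Fin.sequence rawApplicative (λ _ → ¬¬-excluded-middle)
  where open RawMonad ¬¬-Monad using (rawApplicative)

subset : {S : VSet n} → Decidable S → Subset n
subset S? = tabulate (does ∘ S?)

∈-subset⁺ : ∀ {S : VSet n} (S? : Decidable S) {x} → S x → x ∈ₛ subset S?
∈-subset⁺ S? {x} s = lookup⇒[]= x (subset S?) (trans (lookup∘tabulate (does ∘ S?) x) (dec-true (S? x) s))

∈-subset⁻ : ∀ {S : VSet n} (S? : Decidable S) {x} → x ∈ₛ subset S? → S x
∈-subset⁻ S? {x} x∈ with S? x | trans (sym (lookup∘tabulate (does ∘ S?) x)) ([]=⇒lookup x∈)
... | yes s | _  = s
... | no _  | ()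

distinct4? : ∀ (a b c d : Fin n) → Dec (Distinct4 a b c d)
distinct4? a b c d = ¬? (a ≟ b) ×-dec ¬? (a ≟ c) ×-dec ¬? (a ≟ d) ×-dec ¬? (b ≟ c) ×-dec ¬? (b ≟ d) ×-dec ¬? (c ≟ d)

module _ {e : Adjacency n} {S : VSet n} (S? : Decidable S) where

  inducedP4? : ∀ a b c d → Dec (InducedP4 e S a b c d)
  inducedP4? a b c d =
    S? a ×-dec S? b ×-dec S? c ×-dec S? d ×-dec distinct4? a b c d ×-dec
    e a b Bool.≟ true ×-dec e b c Bool.≟ true ×-dec e c d Bool.≟ true ×-dec
    e a c Bool.≟ false ×-dec e b d Bool.≟ false ×-dec e a d Bool.≟ false

  inducedC4? : ∀ a b c d → Dec (InducedC4 e S a b c d)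
  inducedC4? a b c d =
    S? a ×-dec S? b ×-dec S? c ×-dec S? d ×-dec distinct4? a b c d ×-dec
    e a b Bool.≟ true ×-dec e b c Bool.≟ true ×-dec e c d Bool.≟ true ×-dec e d a Bool.≟ true ×-dec
    e a c Bool.≟ false ×-dec e b d Bool.≟ false

  trivPerfOn? : Dec (TrivPerfOn e S)
  trivPerfOn? = Fin.all? λ a → Fin.all? λ b → Fin.all? λ c → Fin.all? λ d →
    ¬? (inducedP4? a b c d) ×-dec ¬? (inducedC4? a b c d)

  isModuleOf? : Dec (IsModuleOf e S)
  isModuleOf? = Fin.all? λ u → Fin.all? λ v → Fin.all? λ w →
    S? u →-dec S? v →-dec ¬? (S? w) →-dec e u w Bool.≟ e v w

module Hull (G : Graph n) (D : Pairs n) {u v} (u∈D : u ∈ endpoints D) (v∈D : v ∈ endpoints D)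
            (u≢v : u ≢ v) (u≁v : adj G u v ≡ false) where

  admissible? : (S : Subset n) → Dec (Admissible G D (_∈ₛ S))
  admissible? S = map′ (λ ends → All.lookup ends) All.tabulate (All.all? (_∈ₛ? S) (endpoints D))
                  ×-dec isModuleOf? (_∈ₛ? S) ×-dec trivPerfOn? (_∈ₛ? S)

  Admissible-cong : ∀ {S T : VSet n} → S ⊆ T → T ⊆ S → Admissible G D S → Admissible G D T
  Admissible-cong S⊆T T⊆S (ends , mod , tp) =
    S⊆T ∘ ends , (λ a b w Ta Tb ¬Tw → mod a b w (T⊆S Ta) (T⊆S Tb) (¬Tw ∘ S⊆T)) , TrivPerfOn-anti T⊆S tp

  InHull : VSet n
  InHull x = ∃ λ (S : Subset n) → Admissible G D (_∈ₛ S) × x ∈ₛ S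

  inHull? : Decidable InHull
  inHull? x = anySubset? (λ S → admissible? S ×-dec (x ∈ₛ? S))

  -- Membership in the hull is decidable, hence stable, so M may be assumed decidable here.
  hull-maximal : ∀ {M : VSet n} → Admissible G D M → M ⊆ InHull
  hull-maximal {M} adm {x} Mx = decidable-stable (inHull? x) λ x∉ → ¬¬-decidable M λ M? →
    x∉ (subset M? , Admissible-cong (∈-subset⁺ M?) (∈-subset⁻ M?) adm , ∈-subset⁺ M? Mx)

  admissible-∪ : ∀ {S T} → Admissible G D (_∈ₛ S) → Admissible G D (_∈ₛ T) → Admissible G D (_∈ₛ S Subset.∪ T)
  admissible-∪ {S} {T} (ends-S , mod-S , tp-S) (ends-T , mod-T , tp-T) =
    Admissible-cong x∈p∪q⁺ (x∈p∪q⁻ S T) (inj₁ ∘ ends-S , ∪-module , ∪-trivPerf)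
    where open ModuleUnion G (_∈ₛ? S) (_∈ₛ? T) mod-S mod-T tp-S tp-T (ends-S u∈D) (ends-T u∈D) (ends-S v∈D) (ends-T v∈D) u≢v u≁v

  hull-cover : ∀ {x xs} → All InHull (x ∷ xs) → ∃ λ S → Admissible G D (_∈ₛ S) × All (_∈ₛ S) (x ∷ xs)
  hull-cover ((S , adm , x∈S) ∷ []) = S , adm , x∈S ∷ []
  hull-cover ((S , adm , x∈S) ∷ hs@(_ ∷ _)) with T , adm-T , all-T ← hull-cover hs =
    S Subset.∪ T , admissible-∪ adm adm-T , x∈p∪q⁺ (inj₁ x∈S) ∷ All.map (x∈p∪q⁺ ∘ inj₂) all-T

  hull-module : IsModuleOf (adj G) InHull
  hull-module a b w ha hb w∉ with S , adm@(_ , mod-S , _) , a∈S ∷ b∈S ∷ [] ← hull-cover (ha ∷ hb ∷ []) =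
    mod-S a b w a∈S b∈S (λ w∈S → w∉ (S , adm , w∈S))

  hull-trivPerf : TrivPerfOn (adj G) InHull
  hull-trivPerf a b c d = noP4 , noC4
    where
    noP4 : ¬ InducedP4 (adj G) InHull a b c d
    noP4 (ha , hb , hc , hd , rest) with _ , (_ , _ , tp-S) , sa ∷ sb ∷ sc ∷ sd ∷ [] ← hull-cover (ha ∷ hb ∷ hc ∷ hd ∷ []) =
      proj₁ (tp-S a b c d) (sa , sb , sc , sd , rest)
    noC4 : ¬ InducedC4 (adj G) InHull a b c d
    noC4 (ha , hb , hc , hd , rest) with _ , (_ , _ , tp-S) , sa ∷ sb ∷ sc ∷ sd ∷ [] ← hull-cover (ha ∷ hb ∷ hc ∷ hd ∷ []) =
      proj₂ (tp-S a b c d) (sa , sb , sc , sd , rest)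

  hull-admissible : ∀ {M : VSet n} → Admissible G D M → Admissible G D InHull
  hull-admissible adm = (λ z∈ → hull-maximal adm (proj₁ adm z∈)) , hull-module , hull-trivPerf

anti-matching-endpoints : ∀ {G : Graph n} {M D} → IsAntiMatchingIn G M D → ∀ {z} → z ∈ endpoints D → M z
anti-matching-endpoints (anti , _) z∈ with _ , p∈D , z∈p ← find (∈-concatMap⁻ vertices z∈) with All.lookup anti p∈D | z∈p
... | Mx , _ , _ | here refl         = Mx
... | _ , My , _ | there (here refl) = My

lemma3 : ∀ {n} (G : Graph n) (k : ℕ) (M : VSet n) (D : Pairs n) →
         IsModule G M → TrivPerfOn (adj G) M →
         IsAntiMatchingIn G M D → length D ≡ suc k →
         YesInstance G k ⇔ YesInstanceOn G (KeptVertices M D) k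
lemma3 G k M [] _ _ _ ()
lemma3 {n} G k M D@((u , v) ∷ _) M-mod M-tp anti@(anti-pairs , D-unique) |D|≡1+k = mk⇔ forward backward
  where
  u≁v : adj G u v ≡ false
  u≁v = proj₂ (proj₂ (All.head anti-pairs))

  M-admissible : Admissible G D M
  M-admissible = anti-matching-endpoints {G = G} anti , M-mod , M-tp

  open Hull G D (here refl) (there (here refl)) (All.head (endpoints-distinct {D = D} D-unique)) u≁v
  open Shrinking G (All.map (proj₂ ∘ proj₂) anti-pairs) D-unique inHull? (hull-admissible M-admissible)

  fewer : ∀ (F : EditSet n) → length (pairs F) ≤ k → length (pairs F) < length D
  fewer F |F|≤k = subst (length (pairs F) <_) (sym |D|≡1+k) (s≤s |F|≤k)

  outside⊆kept : ∁ InHull ⊆ ∁ M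
  outside⊆kept = contraposition (hull-maximal M-admissible)

  kept : ∁ InHull ∪ (_∈ endpoints D) ⊆ KeptVertices M D
  kept = Sum.map outside⊆kept id

  forward : YesInstance G k → YesInstanceOn G (KeptVertices M D) k
  forward (F , _ , |F|≤k , tp) =
    let F′ , F′-out , |F′|≤|F| , tp′ = shrink F (fewer F |F|≤k) (TrivPerfOn-anti _ tp)
    in  F′ , All.map (Product.map (inj₁ ∘ outside⊆kept) (inj₁ ∘ outside⊆kept)) F′-out ,
        ≤-trans |F′|≤|F| |F|≤k , TrivPerfOn-anti _ tp′

  backward : YesInstanceOn G (KeptVertices M D) k → YesInstance G k
  backward (F , _ , |F|≤k , tp) =
    let F′ , F′-out , |F′|≤|F| , tp′ = shrink F (fewer F |F|≤k) (TrivPerfOn-anti kept tp)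
    in  F′ , All.map (λ _ → tt , tt) F′-out , ≤-trans |F′|≤|F| |F|≤k , tp′
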